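{- A finite loopless multigraph $G$ has a full functional orientation if and only if every connected component of $G$ is acyclic or unicyclic (i.e., contains at most one cycle).
   Context: Multigraphs may have parallel edges (two parallel edges form a cycle of length 2) but no loops. An isolated vertex is a vertex of degree $0$. A functional orientation of $G$ is an assignment of directions to a set of edges such that every non-isolated vertex has exactly one edge directed away from it; an edge may be assigned both directions (then it is directed away from both endpoints) or remain undirected. A full functional orientation is a functional orientation that leaves no edge undirected. -}

module Defs where

open import Data.Nat using (ℕ; zero; suc)
open import Data.Fin using (Fin; zero; suc)
open import Data.Product using (Σ; ∃; _×_; _,_; proj₁; proj₂)
open import Data.Sum using (_⊎_)
open import Relation.Binary.PropositionalEquality using (_≡_; _≢_)
open import Function.Definitions using (Injective)
open import Function.Bundles using (_⇔_)

-- A finite loopless multigraph: vertices Fin n, edges Fin m (so parallel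
-- edges are allowed), each edge has two distinct endpoints.
record Multigraph : Set where
  field
    n     : ℕ
    m     : ℕ
    ends  : Fin m → Fin n × Fin n
    loopless : ∀ e → proj₁ (ends e) ≢ proj₂ (ends e)

module _ (G : Multigraph) where
  open Multigraph G

  Joins : Fin m → Fin n → Fin n → Set
  Joins e u v = (ends e ≡ (u , v)) ⊎ (ends e ≡ (v , u))

  Incident : Fin n → Fin m → Set
  Incident v e = (proj₁ (ends e) ≡ v) ⊎ (proj₂ (ends e) ≡ v)

  data Reach : Fin n → Fin n → Set where
    here : ∀ {v} → Reach v v
    step : ∀ {u w v} (e : Fin m) → Joins e u w → Reach w v → Reach u v

  -- cyclic successor on Fin (suc k): i ↦ i+1 mod (suc k)
  next : ∀ {k} → Fin (suc k) → Fin (suc k)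
  next {zero} zero = zero
  next {suc k} zero = suc zero
  next {suc k} (suc i) with next {k} i
  ... | zero = zero
  ... | suc j = suc (suc j)

  -- a cycle of length L+2: distinct vertices v_0..v_{L+1}, distinct edges
  -- e_0..e_{L+1}, edge e_i joining v_i and v_{i+1 mod (L+2)}
  record Cycle : Set where
    field
      L     : ℕ
      verts : Fin (suc (suc L)) → Fin n
      edges : Fin (suc (suc L)) → Fin m
      verts-inj : Injective _≡_ _≡_ verts
      edges-inj : Injective _≡_ _≡_ edges
      joins : ∀ i → Joins (edges i) (verts i) (verts (next i))

  -- two cycles are the same cycle (subgraph) iff they have the same edge set
  SameCycle : Cycle → Cycle → Set
  SameCycle C D = ∀ e → ((∃ λ i → Cycle.edges C i ≡ e) ⇔ (∃ λ j → Cycle.edges D j ≡ e))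

  ComponentsAtMostUnicyclic : Set
  ComponentsAtMostUnicyclic =
    ∀ (C D : Cycle) → Reach (Cycle.verts C zero) (Cycle.verts D zero) → SameCycle C D

  -- orientation status of an edge (u , v) = ends e
  data Dir : Set where
    undirected forward backward both : Dir

  Away : (Fin m → Dir) → Fin n → Fin m → Set
  Away o v e with o e
  ... | undirected = Data.Empty.⊥ where import Data.Empty
  ... | forward  = proj₁ (ends e) ≡ v
  ... | backward = proj₂ (ends e) ≡ v
  ... | both     = Incident v e

  FunctionalOrientation : (Fin m → Dir) → Set
  FunctionalOrientation o =
    ∀ v → (∃ λ e → Incident v e) →
      ∃ λ e → Away o v e × (∀ e' → Away o v e' → e' ≡ e)

  Full : (Fin m → Dir) → Set
  Full o = ∀ e → o e ≢ undirected

  HasFullFunctionalOrientation : Set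
  HasFullFunctionalOrientation = ∃ λ o → FunctionalOrientation o × Full o

-- Both directions pass through *selections*: every non-isolated vertex selects
-- one incident edge and every edge is selected by at least one endpoint.
-- "Directed away from v" is a selection, and a decidable selection is realised
-- by directing each edge away from the endpoints that select it.
-- (⇒) Around a cycle all edges are selected in the same rotational sense, so
-- the cycle is closed under "step along the selected edge" and every vertex of
-- its component steps onto it; two cycles of one component thus share a
-- vertex, and then each selects the other's edges, so they coincide.
-- (⇐) Edges are given, one at a time, to distinct owning endpoints.  The next
-- edge e = uv goes to u (or v) after an augmenting path turns u into a vertex
-- owning nothing; if neither u nor v leads to such a vertex, both lead onto
-- cycles of owned edges, and e would close a second cycle in their component.
-- In the end every vertex selects the edge it owns, or any incident edge.
module Submission where

open import Defs
open import Data.Bool using (Bool; true; false; not; if_then_else_)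
open import Data.Empty using (⊥; ⊥-elim)
open import Data.Fin as F using (Fin; zero; suc; toℕ; fromℕ; inject₁)
open import Data.Fin.Induction using (<-weakInduction; >-weakInduction)
import Data.Fin.Properties as FP
open import Data.Fin.Relation.Unary.Top using (view; ‵fromℕ; ‵inj₁)
open import Data.List using (List; []; _∷_)
open import Data.List.Membership.Propositional using (_∈_; _∉_)
import Data.List.Membership.DecPropositional as DecMembership
open import Data.List.Relation.Unary.Any using (here; there)
open import Data.Maybe using (Maybe; just; nothing)
import Data.Maybe.Properties as Maybe
open import Data.Nat as ℕ using (ℕ; zero; suc; _+_)
open import Data.Nat.GeneralisedArithmetic using (fold; fold-+)
import Data.Nat.Properties as ℕP
open import Data.Product using (Σ; ∃; _×_; _,_; proj₁; proj₂)
open import Data.Product.Properties using (,-injectiveˡ; ,-injectiveʳ)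
open import Data.Sum using (_⊎_; inj₁; inj₂; [_,_]′; swap)
open import Data.Unit using (⊤; tt)
open import Function.Base using (id; _∘_; flip)
open import Function.Bundles using (_⇔_; mk⇔; Equivalence)
open import Function.Definitions using (Injective)
open import Relation.Binary.Construct.Closure.ReflexiveTransitive using (Star; ε; _◅_; _◅◅_)
open import Relation.Binary.Core using (Rel)
open import Relation.Binary.Definitions using (Reflexive; Transitive; Decidable)
open import Relation.Binary.PropositionalEquality
open import Relation.Nullary using (¬_; ¬?; Dec; yes; no; does)
open import Relation.Nullary.Decidable using (_×-dec_; _⊎-dec_; decidable-stable)

module _ (G : Multigraph) where
  open Multigraph G
  open DecMembership (F._≟_ {n}) using (_∈?_)

  next-inject₁ : ∀ {k} (i : Fin k) → next G (inject₁ i) ≡ suc i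
  next-inject₁ {suc zero} zero = refl
  next-inject₁ {suc (suc k)} zero = refl
  next-inject₁ {suc (suc k)} (suc i) rewrite next-inject₁ i = refl

  next-fromℕ : ∀ k → next G (fromℕ k) ≡ zero
  next-fromℕ zero = refl
  next-fromℕ (suc k) rewrite next-fromℕ k = refl

  next-surjective : ∀ {k} (i : Fin (suc k)) → ∃ λ j → next G j ≡ i
  next-surjective zero = fromℕ _ , next-fromℕ _
  next-surjective (suc i) = inject₁ i , next-inject₁ i

  next-no-fixpoint : ∀ {k} (i : Fin (suc (suc k))) → next G i ≢ i
  next-no-fixpoint {k} i with view i
  ... | ‵fromℕ rewrite next-fromℕ (suc k) = λ ()
  ... | ‵inj₁ {i = j} _ rewrite next-inject₁ j =
    λ eq → ℕP.1+n≢n (trans (cong toℕ eq) (FP.toℕ-inject₁ j))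

  next-suc-no-return : ∀ {k} (j : Fin (suc (suc k))) → next G (suc j) ≢ inject₁ j
  next-suc-no-return {k} j with view j
  ... | ‵fromℕ rewrite next-fromℕ (suc (suc k)) = λ ()
  ... | ‵inj₁ {i = j′} _ rewrite next-inject₁ (suc j′) = λ eq →
    ℕP.<⇒≢ (ℕP.m<n⇒m<1+n (ℕP.n<1+n (toℕ j′)))
      (sym (trans (cong toℕ eq) (trans (FP.toℕ-inject₁ (inject₁ j′)) (FP.toℕ-inject₁ j′))))

  next²-no-fixpoint : ∀ {k} (i : Fin (suc (suc (suc k)))) → next G (next G i) ≢ i
  next²-no-fixpoint {k} i with view i
  ... | ‵fromℕ rewrite next-fromℕ (suc (suc k)) = λ ()
  ... | ‵inj₁ {i = j} _ rewrite next-inject₁ j = next-suc-no-return j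

  next-connects : ∀ {k ℓ} (R : Rel (Fin (suc k)) ℓ) → Reflexive R → Transitive R →
                  (∀ i → R i (next G i)) → ∀ i j → R i j
  next-connects {k} R refl′ trans′ succ-related i j = trans′ (to-zero i) (from-zero j)
    where
      from-zero : ∀ j → R zero j
      from-zero = <-weakInduction (R zero) refl′
        λ i r → trans′ r (subst (R (inject₁ i)) (next-inject₁ i) (succ-related (inject₁ i)))
      to-zero : ∀ i → R i zero
      to-zero = >-weakInduction (λ i → R i zero)
        (subst (R (fromℕ k)) (next-fromℕ k) (succ-related (fromℕ k)))
        λ i r → trans′ (subst (R (inject₁ i)) (next-inject₁ i) (succ-related (inject₁ i))) r

  joins-same-ends : ∀ {e a b c d} → Joins G e a b → Joins G e c d →
                    (a ≡ c × b ≡ d) ⊎ (a ≡ d × b ≡ c)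
  joins-same-ends (inj₁ p) (inj₁ q) = inj₁ (,-injectiveˡ (trans (sym p) q) , ,-injectiveʳ (trans (sym p) q))
  joins-same-ends (inj₁ p) (inj₂ q) = inj₂ (,-injectiveˡ (trans (sym p) q) , ,-injectiveʳ (trans (sym p) q))
  joins-same-ends (inj₂ p) (inj₁ q) = inj₂ (,-injectiveʳ (trans (sym p) q) , ,-injectiveˡ (trans (sym p) q))
  joins-same-ends (inj₂ p) (inj₂ q) = inj₁ (,-injectiveʳ (trans (sym p) q) , ,-injectiveˡ (trans (sym p) q))

  joins-unique : ∀ {e u w w′} → Joins G e u w → Joins G e u w′ → w ≡ w′
  joins-unique j j′ with joins-same-ends j j′
  ... | inj₁ (_ , w≡w′) = w≡w′
  ... | inj₂ (u≡w′ , w≡u) = trans w≡u u≡w′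

  joins-sym : ∀ {e u w} → Joins G e u w → Joins G e w u
  joins-sym = swap

  joins-distinct : ∀ {e u w} → Joins G e u w → u ≢ w
  joins-distinct {e} (inj₁ p) refl = loopless e (trans (,-injectiveˡ p) (sym (,-injectiveʳ p)))
  joins-distinct {e} (inj₂ p) refl = loopless e (trans (,-injectiveˡ p) (sym (,-injectiveʳ p)))

  joins-ends : ∀ e → Joins G e (proj₁ (ends e)) (proj₂ (ends e))
  joins-ends e = inj₁ refl

  -- the endpoint of e opposite to x (meaningful when x is incident to e)
  opposite : Fin m → Fin n → Fin n
  opposite e x with proj₁ (ends e) F.≟ x
  ... | yes _ = proj₂ (ends e)
  ... | no _ = proj₁ (ends e)

  joins-opposite : ∀ {e x} → Incident G x e → Joins G e x (opposite e x)
  joins-opposite {e} {x} i with proj₁ (ends e) F.≟ x | i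
  ... | yes p | _ = inj₁ (cong₂ _,_ p refl)
  ... | no ¬p | inj₁ p = ⊥-elim (¬p p)
  ... | no _ | inj₂ p = inj₂ (cong₂ _,_ refl p)

  record Selection (S : Fin n → Fin m → Set) : Set where
    field
      incident   : ∀ {v e} → S v e → Incident G v e
      functional : ∀ {v e e′} → S v e → S v e′ → e ≡ e′
      total      : ∀ v → (∃ λ e → Incident G v e) → ∃ (S v)
      covering   : ∀ e → S (proj₁ (ends e)) e ⊎ S (proj₂ (ends e)) e

    covering-joins : ∀ {e u w} → Joins G e u w → S u e ⊎ S w e
    covering-joins {e} (inj₁ p) =
      subst₂ (λ a b → S a e ⊎ S b e) (,-injectiveˡ p) (,-injectiveʳ p) (covering e)
    covering-joins {e} (inj₂ p) =
      subst₂ (λ a b → S a e ⊎ S b e) (,-injectiveʳ p) (,-injectiveˡ p) (swap (covering e))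

  orientation⇒selection : ∀ {o} → FunctionalOrientation G o → Full G o → Selection (Away G o)
  orientation⇒selection {o} fo full = record
    { incident = away-incident ; functional = away-functional ; total = total ; covering = covering }
    where
      away-incident : ∀ {v e} → Away G o v e → Incident G v e
      away-incident {v} {e} a with o e
      ... | forward = inj₁ a
      ... | backward = inj₂ a
      ... | both = a
      away-functional : ∀ {v e e′} → Away G o v e → Away G o v e′ → e ≡ e′
      away-functional {v} {e} {e′} a a′ with fo v (e , away-incident a)
      ... | _ , _ , unique = trans (unique e a) (sym (unique e′ a′))
      total : ∀ v → (∃ λ e → Incident G v e) → ∃ (Away G o v)
      total v i = proj₁ (fo v i) , proj₁ (proj₂ (fo v i))
      covering : ∀ e → Away G o (proj₁ (ends e)) e ⊎ Away G o (proj₂ (ends e)) e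
      covering e with o e | full e
      ... | undirected | not-undirected = ⊥-elim (not-undirected refl)
      ... | forward | _ = inj₁ refl
      ... | backward | _ = inj₂ refl
      ... | both | _ = inj₁ (inj₁ refl)

  module _ {S : Fin n → Fin m → Set} (S? : Decidable S) (sel : Selection S) where
    open Selection sel

    orientation : Fin m → Dir G
    orientation e with S? (proj₁ (ends e)) e | S? (proj₂ (ends e)) e
    ... | yes _ | yes _ = both
    ... | yes _ | no _ = forward
    ... | no _ | yes _ = backward
    ... | no _ | no _ = forward

    away⇔selected : ∀ v e → Away G orientation v e ⇔ S v e
    away⇔selected v e = mk⇔ to from
      where
        to : Away G orientation v e → S v e
        to a with S? (proj₁ (ends e)) e | S? (proj₂ (ends e)) e
        to a | yes s₁ | yes s₂ = [ (λ { refl → s₁ }) , (λ { refl → s₂ }) ]′ a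
        to refl | yes s₁ | no _ = s₁
        to refl | no _ | yes s₂ = s₂
        to a | no ¬s₁ | no ¬s₂ = ⊥-elim ([ ¬s₁ , ¬s₂ ]′ (covering e))
        from : S v e → Away G orientation v e
        from s with S? (proj₁ (ends e)) e | S? (proj₂ (ends e)) e | incident s
        ... | yes _ | yes _ | i = i
        ... | yes _ | no _ | inj₁ p = p
        ... | yes _ | no ¬s₂ | inj₂ refl = ⊥-elim (¬s₂ s)
        ... | no ¬s₁ | yes _ | inj₁ refl = ⊥-elim (¬s₁ s)
        ... | no _ | yes _ | inj₂ p = p
        ... | no ¬s₁ | no _ | inj₁ refl = ⊥-elim (¬s₁ s)
        ... | no _ | no ¬s₂ | inj₂ refl = ⊥-elim (¬s₂ s)

    selection⇒orientation : HasFullFunctionalOrientation G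
    selection⇒orientation = orientation , functional-orientation , full
      where
        functional-orientation : FunctionalOrientation G orientation
        functional-orientation v i with total v i
        ... | e , s = e , Equivalence.from (away⇔selected v e) s ,
                      λ e′ a → functional (Equivalence.to (away⇔selected v e′) a) s
        full : Full G orientation
        full e with S? (proj₁ (ends e)) e | S? (proj₂ (ends e)) e
        ... | yes _ | yes _ = λ ()
        ... | yes _ | no _ = λ ()
        ... | no _ | yes _ = λ ()
        ... | no _ | no _ = λ ()

  module _ {S : Fin n → Fin m → Set} (sel : Selection S) where
    open Selection sel

    Step : Fin n → Fin n → Set
    Step x y = ∃ λ e → S x e × Joins G e x y

    step-unique : ∀ {x y y′} → Step x y → Step x y′ → y ≡ y′
    step-unique (e , s , j) (e′ , s′ , j′) rewrite functional s s′ = joins-unique j j′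

    joins-step : ∀ {e x y} → Joins G e x y → Step x y ⊎ Step y x
    joins-step j with covering-joins j
    ... | inj₁ s = inj₁ (_ , s , j)
    ... | inj₂ s = inj₂ (_ , s , joins-sym j)

    module SelectionOnCycle (C : Cycle G) where
      open Cycle C

      OnCycle : Fin n → Set
      OnCycle x = ∃ λ i → verts i ≡ x

      Tail Head : Fin (suc (suc L)) → Set
      Tail i = S (verts i) (edges i)
      Head i = S (verts (next G i)) (edges i)

      -- two consecutive cycle edges cannot both be selected by their common vertex
      head-propagates : ∀ i → Head i → Head (next G i)
      head-propagates i h with covering-joins (joins (next G i))
      ... | inj₁ t = ⊥-elim (next-no-fixpoint i (sym (edges-inj (functional h t))))
      ... | inj₂ h′ = h′

      tail-propagates : ∀ i → Tail (next G i) → Tail i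
      tail-propagates i t with covering-joins (joins i)
      ... | inj₁ t′ = t′
      ... | inj₂ h = ⊥-elim (next-no-fixpoint i (sym (edges-inj (functional h t))))

      coherent : (∀ i → Tail i) ⊎ (∀ i → Head i)
      coherent with covering-joins (joins zero)
      ... | inj₁ t₀ = inj₁ λ i →
        next-connects (λ a b → Tail b → Tail a) id (λ f g → f ∘ g) tail-propagates i zero t₀
      ... | inj₂ h₀ = inj₂ λ i →
        next-connects (λ a b → Head a → Head b) id (λ f g → g ∘ f) head-propagates zero i h₀

      cycle-step : ∀ i → ∃ λ k → S (verts i) (edges k) × ∃ λ j → Joins G (edges k) (verts i) (verts j)
      cycle-step i with coherent
      ... | inj₁ tails = i , tails i , next G i , joins i
      ... | inj₂ heads with next-surjective i
      ...   | k , refl = k , heads k , k , joins-sym (joins k)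

      edge-selected : ∀ k → ∃ λ i → S (verts i) (edges k)
      edge-selected k with coherent
      ... | inj₁ tails = k , tails k
      ... | inj₂ heads = next G k , heads k

      closed-step : ∀ {x y} → OnCycle x → Step x y → OnCycle y
      closed-step (i , refl) st with cycle-step i
      ... | k , s , j , jn = j , step-unique (edges k , s , jn) st

      closed : ∀ {x y} → OnCycle x → Star Step x y → OnCycle y
      closed c ε = c
      closed c (st ◅ sts) = closed (closed-step c st) sts

      strongly-connected : ∀ i j → Star Step (verts i) (verts j)
      strongly-connected i j with coherent
      ... | inj₁ tails = next-connects (λ a b → Star Step (verts a) (verts b)) ε _◅◅_
                           (λ a → (edges a , tails a , joins a) ◅ ε) i j
      ... | inj₂ heads = next-connects (λ a b → Star Step (verts b) (verts a)) ε (flip _◅◅_)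
                           (λ a → (edges a , heads a , joins-sym (joins a)) ◅ ε) j i

      Feeds : Fin n → Set
      Feeds x = ∃ λ z → Star Step x z × OnCycle z

      feeds-forward : ∀ {x y} → Step x y → Feeds x → Feeds y
      feeds-forward st (z , ε , c) = _ , ε , closed-step c st
      feeds-forward st (z , st′ ◅ sts , c) rewrite step-unique st′ st = z , sts , c

      feeds-backward : ∀ {x y} → Step x y → Feeds y → Feeds x
      feeds-backward st (z , sts , c) = z , st ◅ sts , c

      feeds-reach : ∀ {x y} → Reach G x y → Feeds x → Feeds y
      feeds-reach here f = f
      feeds-reach (step e j r) f with joins-step j
      ... | inj₁ st = feeds-reach r (feeds-forward st f)
      ... | inj₂ st = feeds-reach r (feeds-backward st f)

    open SelectionOnCycle

    shared-vertex⇒included : ∀ (C D : Cycle G) {z} → OnCycle C z → OnCycle D z →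
                             ∀ k → ∃ λ k′ → Cycle.edges D k′ ≡ Cycle.edges C k
    shared-vertex⇒included C D (i , refl) onD k with edge-selected C k
    ... | i′ , s with closed D onD (strongly-connected C i i′)
    ...   | j , eq with cycle-step D j
    ...     | k′ , s′ , _ = k′ , functional s′ (subst (λ x → S x (Cycle.edges C k)) (sym eq) s)

    selection⇒unicyclic : ComponentsAtMostUnicyclic G
    selection⇒unicyclic C D r e = mk⇔ (C⊆D C D on-C on-D) (C⊆D D C on-D on-C)
      where
        fed : Feeds C (Cycle.verts D zero)
        fed = feeds-reach C r (Cycle.verts C zero , ε , zero , refl)
        on-C : OnCycle C (proj₁ fed)
        on-C = proj₂ (proj₂ fed)
        on-D : OnCycle D (proj₁ fed)
        on-D = closed D (zero , refl) (proj₁ (proj₂ fed))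
        C⊆D : ∀ (C′ D′ : Cycle G) {z} → OnCycle C′ z → OnCycle D′ z →
              (∃ λ i → Cycle.edges C′ i ≡ e) → ∃ λ j → Cycle.edges D′ j ≡ e
        C⊆D C′ D′ c d (i , refl) = shared-vertex⇒included C′ D′ c d i

  data Walk (P : Fin n → Fin m → Set) : Fin n → Fin n → Set where
    []   : ∀ {a} → Walk P a a
    cons : ∀ {a b c} (e : Fin m) → P a e → Joins G e a b → Walk P b c → Walk P a c

  module _ {P : Fin n → Fin m → Set} where
    length : ∀ {a c} → Walk P a c → ℕ
    length [] = zero
    length (cons _ _ _ w) = suc (length w)

    vertices : ∀ {a c} → Walk P a c → List (Fin n)
    vertices {a} [] = a ∷ []
    vertices {a} (cons _ _ _ w) = a ∷ vertices w

    -- the i-th vertex and the i-th edge; past the end these are c and d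
    vertex-at : ∀ {a c} → Walk P a c → ℕ → Fin n
    vertex-at {a} _ zero = a
    vertex-at {a} [] (suc i) = a
    vertex-at (cons _ _ _ w) (suc i) = vertex-at w i

    edge-at : ∀ {a c} → Fin m → Walk P a c → ℕ → Fin m
    edge-at d [] _ = d
    edge-at d (cons e _ _ _) zero = e
    edge-at d (cons _ _ _ w) (suc i) = edge-at d w i

    vertex-at-length : ∀ {a c} (w : Walk P a c) → vertex-at w (length w) ≡ c
    vertex-at-length [] = refl
    vertex-at-length (cons _ _ _ w) = vertex-at-length w

    edge-at-length : ∀ {a c} d (w : Walk P a c) → edge-at d w (length w) ≡ d
    edge-at-length d [] = refl
    edge-at-length d (cons _ _ _ w) = edge-at-length d w

    vertex-at-∈ : ∀ {a c} (w : Walk P a c) i → vertex-at w i ∈ vertices w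
    vertex-at-∈ [] zero = here refl
    vertex-at-∈ [] (suc i) = here refl
    vertex-at-∈ (cons _ _ _ w) zero = here refl
    vertex-at-∈ (cons _ _ _ w) (suc i) = there (vertex-at-∈ w i)

    joins-at : ∀ {a c} d (w : Walk P a c) i → i ℕ.< length w →
               Joins G (edge-at d w i) (vertex-at w i) (vertex-at w (suc i))
    joins-at d (cons _ _ j _) zero _ = j
    joins-at d (cons _ _ _ w) (suc i) (ℕ.s≤s i<) = joins-at d w i i<

    edge-at-condition : ∀ {a c} d (w : Walk P a c) i → edge-at d w i ≡ d ⊎ P (vertex-at w i) (edge-at d w i)
    edge-at-condition d [] i = inj₁ refl
    edge-at-condition d (cons _ p _ _) zero = inj₂ p
    edge-at-condition d (cons _ _ _ w) (suc i) = edge-at-condition d w i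

    first-condition : ∀ {a c} d (w : Walk P a c) {L} → length w ≡ suc L → P a (edge-at d w 0)
    first-condition d (cons _ p _ _) _ = p

    nonempty : ∀ {a c} → a ≢ c → (w : Walk P a c) → ∃ λ L → length w ≡ suc L
    nonempty a≢c [] = ⊥-elim (a≢c refl)
    nonempty a≢c (cons _ _ _ w) = length w , refl

    Simple : ∀ {a c} → Walk P a c → Set
    Simple [] = ⊤
    Simple {a} (cons _ _ _ w) = a ∉ vertices w × Simple w

    simple-injective : ∀ {a c} (w : Walk P a c) → Simple w → ∀ i j →
                       i ℕ.≤ length w → j ℕ.≤ length w → vertex-at w i ≡ vertex-at w j → i ≡ j
    simple-injective [] _ zero zero _ _ _ = refl
    simple-injective (cons _ _ _ w) _ zero zero _ _ _ = refl
    simple-injective (cons _ _ _ w) (a∉ , _) zero (suc j) _ _ eq =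
      ⊥-elim (a∉ (subst (_∈ vertices w) (sym eq) (vertex-at-∈ w j)))
    simple-injective (cons _ _ _ w) (a∉ , _) (suc i) zero _ _ eq =
      ⊥-elim (a∉ (subst (_∈ vertices w) eq (vertex-at-∈ w i)))
    simple-injective (cons _ _ _ w) (_ , simple) (suc i) (suc j) (ℕ.s≤s i≤) (ℕ.s≤s j≤) eq =
      cong suc (simple-injective w simple i j i≤ j≤ eq)

    _++_ : ∀ {a b c} → Walk P a b → Walk P b c → Walk P a c
    [] ++ w′ = w′
    cons e p j w ++ w′ = cons e p j (w ++ w′)

    length-++ : ∀ {a b c} (w : Walk P a b) (w′ : Walk P b c) → length (w ++ w′) ≡ length w + length w′
    length-++ [] w′ = refl
    length-++ (cons _ _ _ w) w′ = cong suc (length-++ w w′)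

    drop-until : ∀ {a c x} (w : Walk P a c) → x ∈ vertices w → Σ (Walk P x c) λ w′ → Simple w → Simple w′
    drop-until [] (here refl) = [] , id
    drop-until (cons e p j w) (here refl) = cons e p j w , id
    drop-until (cons e p j w) (there x∈) with drop-until w x∈
    ... | w′ , simple′ = w′ , simple′ ∘ proj₂

    shortcut : ∀ {a c} → Walk P a c → Σ (Walk P a c) Simple
    shortcut [] = [] , tt
    shortcut {a} (cons e p j w) with shortcut w
    ... | w′ , simple with a ∈? vertices w′
    ...   | yes a∈ = proj₁ (drop-until w′ a∈) , proj₂ (drop-until w′ a∈) simple
    ...   | no a∉ = cons e p j w′ , a∉ , simple

    unsnoc : ∀ {a c} (w : Walk P a c) → (a ≡ c × length w ≡ 0) ⊎
             (∃ λ x → ∃ λ e → Σ (Walk P a x) λ w′ → P x e × Joins G e x c × suc (length w′) ≡ length w)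
    unsnoc [] = inj₁ (refl , refl)
    unsnoc (cons e p j w) with unsnoc w
    ... | inj₁ (refl , empty) = inj₂ (_ , e , [] , p , j , cong suc (sym empty))
    ... | inj₂ (x , e′ , w′ , p′ , j′ , len) = inj₂ (x , e′ , cons e p j w′ , p′ , j′ , cong suc len)

    walk⇒reach : ∀ {a c} → Walk P a c → Reach G a c
    walk⇒reach [] = here
    walk⇒reach (cons e _ j w) = step e j (walk⇒reach w)

  reach-trans : ∀ {a b c} → Reach G a b → Reach G b c → Reach G a c
  reach-trans here r′ = r′
  reach-trans (step e j r) r′ = step e j (reach-trans r r′)

  walk⇒reach-back : ∀ {P a c} → Walk P a c → Reach G c a
  walk⇒reach-back [] = here
  walk⇒reach-back (cons e _ j w) = reach-trans (walk⇒reach-back w) (step e (joins-sym j) here)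

  relax : ∀ {P Q : Fin n → Fin m → Set} → (∀ {x e} → P x e → Q x e) → ∀ {a c} → Walk P a c → Walk Q a c
  relax f [] = []
  relax f (cons e p j w) = cons e (f p) j (relax f w)

  reverse : ∀ {Q : Fin m → Set} {a c} → Walk (λ _ → Q) a c → Walk (λ _ → Q) c a
  reverse [] = []
  reverse (cons e q j w) = reverse w ++ cons e q (joins-sym j) []

  prune : ∀ {P Q : Fin n → Fin m → Set} {a c} (w : Walk P a c) x →
          (∀ {z e} → z ≢ x → P z e → Q z e) →
          (Σ (Walk Q a c) λ w′ → length w′ ℕ.≤ length w) ⊎ (Σ (Walk P a x) λ w′ → length w′ ℕ.< length w)
  prune [] x agree = inj₁ ([] , ℕ.z≤n)
  prune {a = a} (cons e p j w) x agree with a F.≟ x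
  ... | yes refl = inj₂ ([] , ℕ.s≤s ℕ.z≤n)
  ... | no a≢x with prune w x agree
  ...   | inj₁ (w′ , ≤) = inj₁ (cons e (agree a≢x p) j w′ , ℕ.s≤s ≤)
  ...   | inj₂ (w′ , <) = inj₂ (cons e p j w′ , ℕ.s≤s <)

  -- A closed walk v₀ … v_{L+1} v₀ through distinct vertices uses distinct
  -- edges as soon as consecutive edges differ: equal edges have equal ends.
  consecutive-distinct⇒injective :
    ∀ {L} (vs : Fin (suc (suc L)) → Fin n) (es : Fin (suc (suc L)) → Fin m) →
    Injective _≡_ _≡_ vs → (∀ i → Joins G (es i) (vs i) (vs (next G i))) →
    (∀ i → es i ≢ es (next G i)) → Injective _≡_ _≡_ es
  consecutive-distinct⇒injective vs es vs-inj joins consecutive {i} {j} eq with i F.≟ j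
  ... | yes i≡j = i≡j
  ... | no i≢j with joins-same-ends (joins i) (subst (λ e → Joins G e (vs j) (vs (next G j))) (sym eq) (joins j))
  ...   | inj₁ (same , _) = ⊥-elim (i≢j (vs-inj same))
  ...   | inj₂ (crossed , _) = ⊥-elim (consecutive j (trans (sym eq) (cong es (vs-inj crossed))))

  long-consecutive-distinct :
    ∀ {L} (vs : Fin (suc (suc (suc L))) → Fin n) (es : Fin (suc (suc (suc L))) → Fin m) →
    Injective _≡_ _≡_ vs → (∀ i → Joins G (es i) (vs i) (vs (next G i))) →
    ∀ i → es i ≢ es (next G i)
  long-consecutive-distinct vs es vs-inj joins i eq
    with joins-same-ends (joins i)
           (subst (λ e → Joins G e (vs (next G i)) (vs (next G (next G i)))) (sym eq) (joins (next G i)))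
  ... | inj₁ (same , _) = next-no-fixpoint i (sym (vs-inj same))
  ... | inj₂ (crossed , _) = next²-no-fixpoint i (sym (vs-inj crossed))

  module ClosePath {P : Fin n → Fin m → Set} {a c : Fin n}
           (w : Walk P a c) (simple : Simple w) (a≢c : a ≢ c) (L : ℕ) (len : length w ≡ suc L)
           (d : Fin m) (d-joins : Joins G d c a) (fresh : ∀ {x e} → P x e → x ≢ c → e ≢ d) where

    verts : Fin (suc (suc L)) → Fin n
    verts i = vertex-at w (toℕ i)

    edges : Fin (suc (suc L)) → Fin m
    edges i = edge-at d w (toℕ i)

    -- the last position is closed by d, all others follow the path
    last-index : toℕ (fromℕ (suc L)) ≡ length w
    last-index = trans (FP.toℕ-fromℕ (suc L)) (sym len)

    verts-inj : Injective _≡_ _≡_ verts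
    verts-inj {i} {j} eq = FP.toℕ-injective (simple-injective w simple (toℕ i) (toℕ j) (bound i) (bound j) eq)
      where
        bound : ∀ (i : Fin (suc (suc L))) → toℕ i ℕ.≤ length w
        bound i = subst (toℕ i ℕ.≤_) (sym len) (FP.toℕ≤pred[n] i)

    joins : ∀ i → Joins G (edges i) (verts i) (verts (next G i))
    joins i with view i
    ... | ‵fromℕ rewrite next-fromℕ (suc L) | last-index | edge-at-length d w | vertex-at-length w = d-joins
    ... | ‵inj₁ {i = j} _ rewrite next-inject₁ j | FP.toℕ-inject₁ j =
      joins-at d w (toℕ j) (subst (toℕ j ℕ.<_) (sym len) (FP.toℕ<n j))

    -- for length 2 this is where d must be fresh
    consecutive : ∀ i → edges i ≢ edges (next G i)
    consecutive = short-or-long L refl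
      where
        single-edge-fresh : ∀ (w′ : Walk P a c) → length w′ ≡ 1 → edge-at d w′ 0 ≢ edge-at d w′ 1
        single-edge-fresh (cons e p _ []) _ = fresh p a≢c
        short-or-long : ∀ L′ → L ≡ L′ → ∀ i → edges i ≢ edges (next G i)
        short-or-long zero refl zero = single-edge-fresh w len
        short-or-long zero refl (suc zero) eq = single-edge-fresh w len (sym eq)
        short-or-long (suc L′) refl = long-consecutive-distinct verts edges verts-inj joins

    cycle : Cycle G
    cycle = record { L = L ; verts = verts ; edges = edges ; verts-inj = verts-inj
                   ; edges-inj = consecutive-distinct⇒injective verts edges verts-inj joins consecutive
                   ; joins = joins }

    closing-edge : Cycle.edges cycle (fromℕ (suc L)) ≡ d
    closing-edge = trans (cong (edge-at d w) last-index) (edge-at-length d w)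

  Sides : Set
  Sides = Fin m → Bool

  owner : Sides → Fin m → Fin n
  owner s e = if s e then proj₁ (ends e) else proj₂ (ends e)

  owner-incident : ∀ s e → Incident G (owner s e) e
  owner-incident s e with s e
  ... | true = inj₁ refl
  ... | false = inj₂ refl

  owner-flipped : ∀ s s′ e → s′ e ≡ not (s e) → Joins G e (owner s e) (owner s′ e)
  owner-flipped s s′ e flipped with s e | s′ e
  ... | true | false = inj₁ refl
  ... | false | true = inj₂ refl
  owner-flipped s s′ e () | true | true
  owner-flipped s s′ e () | false | false

  set : Sides → Fin m → Bool → Sides
  set s e b e′ with e′ F.≟ e
  ... | yes _ = b
  ... | no _ = s e′

  set-here : ∀ s e b → set s e b e ≡ b
  set-here s e b with e F.≟ e
  ... | yes _ = refl
  ... | no e≢e = ⊥-elim (e≢e refl)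

  owner-elsewhere : ∀ s e b {e′} → e′ ≢ e → owner (set s e b) e′ ≡ owner s e′
  owner-elsewhere s e b {e′} e′≢e with e′ F.≟ e
  ... | yes e′≡e = ⊥-elim (e′≢e e′≡e)
  ... | no _ = refl

  -- the edges already processed when k edges have been assigned
  Old : ℕ → Fin m → Set
  Old k e = toℕ e ℕ.< k

  Owns : Sides → ℕ → Fin n → Fin m → Set
  Owns s k x e = Old k e × owner s e ≡ x

  Valid : Sides → ℕ → Set
  Valid s k = ∀ {x e e′} → Owns s k x e → Owns s k x e′ → e ≡ e′

  Root : Sides → ℕ → Fin n → Set
  Root s k x = ¬ ∃ (Owns s k x)

  owns? : ∀ s k x e → Dec (Owns s k x e)
  owns? s k x e = (toℕ e ℕ.<? k) ×-dec (owner s e F.≟ x)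

  owned? : ∀ s k x → Dec (∃ (Owns s k x))
  owned? s k x = FP.any? (owns? s k x)

  module Reassign {s k x r e} (valid : Valid s k) (x-owns : Owns s k x e)
                  (x-r : Joins G e x r) (r-root : Root s k r) where

    moved : Sides
    moved = set s e (not (s e))

    owner-moved : owner moved e ≡ r
    owner-moved = joins-unique
      (subst (λ y → Joins G e y (owner moved e)) (proj₂ x-owns) (owner-flipped s moved e (set-here s e _)))
      x-r

    owns-moved : ∀ {z e′} → Owns moved k z e′ → (e′ ≡ e × z ≡ r) ⊎ (e′ ≢ e × Owns s k z e′)
    owns-moved {z} {e′} (old , owns) = by-cases (e′ F.≟ e)
      where
        by-cases : Dec (e′ ≡ e) → (e′ ≡ e × z ≡ r) ⊎ (e′ ≢ e × Owns s k z e′)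
        by-cases (yes e′≡e) = inj₁ (e′≡e , trans (sym owns) (trans (cong (owner moved) e′≡e) owner-moved))
        by-cases (no e′≢e) = inj₂ (e′≢e , old , trans (sym (owner-elsewhere s e _ e′≢e)) owns)

    owns-kept : ∀ {z e′} → z ≢ x → Owns s k z e′ → Owns moved k z e′
    owns-kept {z} {e′} z≢x (old , owns) = old , trans (owner-elsewhere s e _ e′≢e) owns
      where
        e′≢e : e′ ≢ e
        e′≢e refl = z≢x (trans (sym owns) (proj₂ x-owns))

    valid-moved : Valid moved k
    valid-moved o o′ with owns-moved o | owns-moved o′
    ... | inj₁ (refl , _) | inj₁ (refl , _) = refl
    ... | inj₁ (_ , refl) | inj₂ (_ , o″) = ⊥-elim (r-root (_ , o″))
    ... | inj₂ (_ , o″) | inj₁ (_ , refl) = ⊥-elim (r-root (_ , o″))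
    ... | inj₂ (_ , o″) | inj₂ (_ , o‴) = valid o″ o‴

    root-moved : Root moved k x
    root-moved (e′ , o) with owns-moved o
    ... | inj₁ (_ , refl) = joins-distinct x-r refl
    ... | inj₂ (e′≢e , o′) = e′≢e (valid o′ x-owns)

  owner-towards : ∀ s e u → Incident G u e → s e ≡ does (proj₁ (ends e) F.≟ u) → owner s e ≡ u
  owner-towards s e u u-e side rewrite side with proj₁ (ends e) F.≟ u | u-e
  ... | yes p | _ = p
  ... | no ¬p | inj₁ p = ⊥-elim (¬p p)
  ... | no _ | inj₂ p = p

  module Claim {s k u e} (valid : Valid s k) (u-root : Root s k u)
               (e-next : toℕ e ≡ k) (u-e : Incident G u e) where

    claimed : Sides
    claimed = set s e (does (proj₁ (ends e) F.≟ u))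

    owner-claimed : owner claimed e ≡ u
    owner-claimed = owner-towards claimed e u u-e (set-here s e _)

    owns-claimed : ∀ {z e′} → Owns claimed (suc k) z e′ → (e′ ≡ e × z ≡ u) ⊎ Owns s k z e′
    owns-claimed {z} {e′} (old , owns) = by-cases (e′ F.≟ e)
      where
        by-cases : Dec (e′ ≡ e) → (e′ ≡ e × z ≡ u) ⊎ Owns s k z e′
        by-cases (yes e′≡e) = inj₁ (e′≡e , trans (sym owns) (trans (cong (owner claimed) e′≡e) owner-claimed))
        by-cases (no e′≢e) = inj₂ (older , trans (sym (owner-elsewhere s e _ e′≢e)) owns)
          where
            older : Old k e′
            older = ℕP.≤∧≢⇒< (ℕ.s≤s⁻¹ old) λ e′-next → e′≢e (FP.toℕ-injective (trans e′-next (sym e-next)))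

    valid-claimed : Valid claimed (suc k)
    valid-claimed o o′ with owns-claimed o | owns-claimed o′
    ... | inj₁ (refl , _) | inj₁ (refl , _) = refl
    ... | inj₁ (_ , refl) | inj₂ o″ = ⊥-elim (u-root (_ , o″))
    ... | inj₂ o″ | inj₁ (_ , refl) = ⊥-elim (u-root (_ , o″))
    ... | inj₂ o″ | inj₂ o‴ = valid o″ o‴

  move : Sides → ℕ → Fin n → Fin n
  move s k x with owned? s k x
  ... | yes (e , _) = opposite e x
  ... | no _ = x

  owns-incident : ∀ {s k x e} → Owns s k x e → Incident G x e
  owns-incident {s} {e = e} (_ , owns) = subst (λ y → Incident G y e) owns (owner-incident s e)

  move-owned : ∀ {s k x e} → Valid s k → Owns s k x e → Joins G e x (move s k x)
  move-owned {s} {k} {x} valid o with owned? s k x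
  ... | yes (e′ , o′) rewrite valid o o′ = joins-opposite (owns-incident {s} o′)
  ... | no root = ⊥-elim (root (_ , o))

  move-root : ∀ {s k x} → Root s k x → move s k x ≡ x
  move-root {s} {k} {x} root with owned? s k x
  ... | yes o = ⊥-elim (root o)
  ... | no _ = refl

  move-fixed⇒root : ∀ {s k x} → Valid s k → move s k x ≡ x → Root s k x
  move-fixed⇒root valid fixed (_ , o) = joins-distinct (move-owned valid o) (sym fixed)

  trajectory : ∀ s k t x → Walk (Owns s k) x (fold x (move s k) t)
  trajectory s k zero x = []
  trajectory s k (suc t) x with owned? s k (fold x (move s k) t)
  ... | yes (e , o) = trajectory s k t x ++ cons e o (joins-opposite (owns-incident {s} o)) []
  ... | no _ = trajectory s k t x

  eventually-periodic : ∀ (f : Fin n → Fin n) x → ∃ λ t → ∃ λ P → fold (fold x f t) f (suc P) ≡ fold x f t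
  eventually-periodic f x with FP.pigeonhole (ℕP.n<1+n n) (λ i → fold x f (toℕ i))
  ... | i , j , i<j , same with ℕP.m≤n⇒∃[o]m+o≡n i<j
  ...   | P , gap = toℕ i , P , (begin
    fold (fold x f (toℕ i)) f (suc P)  ≡⟨ fold-+ x f (suc P) ⟨
    fold x f (suc P + toℕ i)           ≡⟨ cong (fold x f) (trans (cong suc (ℕP.+-comm P (toℕ i))) gap) ⟩
    fold x f (toℕ j)                   ≡⟨ same ⟨
    fold x f (toℕ i)                   ∎)
    where open ≡-Reasoning

  -- Augmenting path: along an owned walk from u to a root r, hand each edge
  -- over to its other end, last edge first; afterwards u is a root.  When
  -- the walk revisits the current vertex we continue on a shorter walk, so
  -- the recursion is bounded by the length N.
  augment : ∀ N {s k u r} → Valid s k → (w : Walk (Owns s k) u r) → length w ℕ.≤ N →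
            Root s k r → ∃ λ s′ → Valid s′ k × Root s′ k u
  augment N valid w w≤N root with unsnoc w
  ... | inj₁ (refl , _) = _ , valid , root
  augment zero valid w w≤N root | inj₂ (_ , _ , _ , _ , _ , len) with () ← subst (ℕ._≤ 0) (sym len) w≤N
  augment (suc N) valid w w≤N root | inj₂ (x , e , w′ , o , j , len)
    with prune w′ x (Reassign.owns-kept valid o j root)
  ... | inj₁ (w″ , w″≤w′) =
    augment N (Reassign.valid-moved valid o j root) w″ (ℕP.≤-trans w″≤w′ w′≤N) (Reassign.root-moved valid o j root)
    where
      w′≤N : length w′ ℕ.≤ N
      w′≤N = ℕ.s≤s⁻¹ (subst (ℕ._≤ suc N) (sym len) w≤N)
  ... | inj₂ (w″ , w″<w′) = augment N valid (w″ ++ cons e o j []) shorter root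
    where
      shorter : length (w″ ++ cons e o j []) ℕ.≤ N
      shorter = begin
        length (w″ ++ cons e o j [])  ≡⟨ length-++ w″ _ ⟩
        length w″ + 1                 ≡⟨ ℕP.+-comm (length w″) 1 ⟩
        suc (length w″)               ≤⟨ w″<w′ ⟩
        length w′                     ≤⟨ ℕ.s≤s⁻¹ (subst (ℕ._≤ suc N) (sym len) w≤N) ⟩
        N                             ∎
        where open ℕP.≤-Reasoning

  record CycleAt (s : Sides) (k : ℕ) (y : Fin n) : Set where
    field
      last         : Fin n
      closing      : Fin m
      path         : Walk (Owns s k) y last
      simple       : Simple path
      y≢last       : y ≢ last
      owns-closing : Owns s k last closing
      closes       : Joins G closing last y
      L            : ℕ
      length-path  : length path ≡ suc L

    -- the closing edge is owned by `last`, hence not used earlier on the path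
    fresh : ∀ {x e} → Owns s k x e → x ≢ last → e ≢ closing
    fresh o x≢last refl = x≢last (trans (sym (proj₂ o)) (proj₂ owns-closing))

    cycle : Cycle G
    cycle = ClosePath.cycle path simple y≢last L length-path closing closes fresh

    edge-owned : ∀ i → ∃ λ x → x ∈ vertices path × Owns s k x (Cycle.edges cycle i)
    edge-owned i with edge-at-condition closing path (toℕ i)
    ... | inj₁ is-closing = last , subst (_∈ vertices path) (vertex-at-length path) (vertex-at-∈ path (length path))
                                 , subst (Owns s k last) (sym is-closing) owns-closing
    ... | inj₂ o = _ , vertex-at-∈ path (toℕ i) , o

    first-edge-owned : Owns s k y (Cycle.edges cycle zero)
    first-edge-owned = first-condition closing path length-path

  periodic⇒cycle : ∀ {s k y} P → Valid s k → fold y (move s k) (suc P) ≡ y → ¬ Root s k y → CycleAt s k y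
  periodic⇒cycle {s} {k} {y} P valid periodic not-root = record
    { last = last ; closing = proj₁ last-owns ; path = proj₁ path ; simple = proj₂ path ; y≢last = y≢last
    ; owns-closing = proj₂ last-owns
    ; closes = subst (Joins G (proj₁ last-owns) last) periodic (move-owned valid (proj₂ last-owns))
    ; L = proj₁ (nonempty y≢last (proj₁ path)) ; length-path = proj₂ (nonempty y≢last (proj₁ path)) }
    where
      last : Fin n
      last = fold y (move s k) P
      y≢last : y ≢ last
      y≢last y≡last = not-root (move-fixed⇒root valid (trans (cong (move s k) y≡last) periodic))
      last-owns : ∃ (Owns s k last)
      last-owns = decidable-stable (owned? s k last)
        λ last-root → y≢last (trans (sym periodic) (move-root last-root))
      path : Σ (Walk (Owns s k) y last) Simple
      path = shortcut (trajectory s k P y)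

  root-or-cycle : ∀ {s k} → Valid s k → ∀ u →
                  (∃ λ r → Root s k r × Walk (Owns s k) u r) ⊎ (∃ λ y → Walk (Owns s k) u y × CycleAt s k y)
  root-or-cycle {s} {k} valid u with eventually-periodic (move s k) u
  ... | t , P , periodic with owned? s k (fold u (move s k) t)
  ...   | no root = inj₁ (_ , root , trajectory s k t u)
  ...   | yes o = inj₂ (_ , trajectory s k t u , periodic⇒cycle P valid periodic (λ root → root o))

  -- Under the hypothesis, the next edge e cannot join two vertices that both
  -- lead onto functional cycles: those cycles would coincide, and then e
  -- would close a second cycle in their component.
  module NoTwoCycles (unicyclic : ComponentsAtMostUnicyclic G) {s k} {e : Fin m} (e-next : toℕ e ≡ k)
                     {y y′} (to-y : Walk (Owns s k) (proj₁ (ends e)) y) (Cy : CycleAt s k y)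
                     (to-y′ : Walk (Owns s k) (proj₂ (ends e)) y′) (Cy′ : CycleAt s k y′) where
    open CycleAt

    e-new : ∀ {e′} → Old k e′ → e′ ≢ e
    e-new old refl = ℕP.<-irrefl e-next old

    y⇝y′ : Reach G y y′
    y⇝y′ = reach-trans (walk⇒reach-back to-y) (step e (joins-ends e) (walk⇒reach to-y′))

    -- the two functional cycles are one and the same, so y lies on the second
    y-on-second : y ∈ vertices (path Cy′)
    y-on-second with Equivalence.to (unicyclic (cycle Cy) (cycle Cy′) y⇝y′ _) (zero , refl)
    ... | j , same-edge with edge-owned Cy′ j
    ...   | x , x∈ , (_ , owns-x) = subst (_∈ vertices (path Cy′)) x≡y x∈
      where
        x≡y : x ≡ y
        x≡y = trans (sym owns-x) (trans (cong (owner s) same-edge) (proj₂ (first-edge-owned Cy)))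

    OldWalk : Fin n → Fin n → Set
    OldWalk = Walk (λ _ → Old k)

    around : OldWalk (proj₁ (ends e)) (proj₂ (ends e))
    around = relax proj₁ to-y
          ++ (relax proj₁ (proj₁ (drop-until (path Cy′) y-on-second))
          ++ cons (closing Cy′) (proj₁ (owns-closing Cy′)) (closes Cy′) (reverse (relax proj₁ to-y′)))

    around-path : Σ (OldWalk (proj₁ (ends e)) (proj₂ (ends e))) Simple
    around-path = shortcut around

    around-nonempty : ∃ λ L → length (proj₁ around-path) ≡ suc L
    around-nonempty = nonempty (loopless e) (proj₁ around-path)

    -- closing it with e gives a cycle through e
    module Second = ClosePath (proj₁ around-path) (proj₂ around-path) (loopless e)
                      (proj₁ around-nonempty) (proj₂ around-nonempty)
                      e (joins-sym (joins-ends e)) (λ old _ → e-new old)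

    -- which must again be the functional cycle through y, whose edges are all old
    impossible : ⊥
    impossible with Equivalence.from (unicyclic (cycle Cy) Second.cycle (walk⇒reach-back to-y) e)
                      (_ , Second.closing-edge)
    ... | i , is-e with edge-owned Cy i
    ...   | _ , _ , (old , _) = e-new old is-e

  -- Under the hypothesis, one more edge e can always be assigned: an
  -- endpoint of e leads to a root, which augmenting moves to that endpoint.
  module Extend (unicyclic : ComponentsAtMostUnicyclic G) {s k} (valid : Valid s k) (k<m : k ℕ.< m) where
    e : Fin m
    e = F.fromℕ< k<m

    e-next : toℕ e ≡ k
    e-next = FP.toℕ-fromℕ< k<m

    via-root : ∀ {x r} → Incident G x e → Root s k r → Walk (Owns s k) x r → ∃ λ s′ → Valid s′ (suc k)
    via-root x-e root w with augment (length w) valid w ℕP.≤-refl root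
    ... | _ , valid₁ , x-root = Claim.claimed valid₁ x-root e-next x-e , Claim.valid-claimed valid₁ x-root e-next x-e

    extended : ∃ λ s′ → Valid s′ (suc k)
    extended with root-or-cycle valid (proj₁ (ends e)) | root-or-cycle valid (proj₂ (ends e))
    ... | inj₁ (_ , root , w) | _ = via-root (inj₁ refl) root w
    ... | inj₂ _ | inj₁ (_ , root , w) = via-root (inj₂ refl) root w
    ... | inj₂ (_ , to-y , Cy) | inj₂ (_ , to-y′ , Cy′) =
      ⊥-elim (NoTwoCycles.impossible unicyclic e-next to-y Cy to-y′ Cy′)

  assign-all : ComponentsAtMostUnicyclic G → ∀ k → k ℕ.≤ m → ∃ λ s → Valid s k
  assign-all unicyclic zero _ = (λ _ → true) , λ ()
  assign-all unicyclic (suc k) k<m with assign-all unicyclic k (ℕP.<⇒≤ k<m)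
  ... | s , valid = Extend.extended unicyclic valid k<m

  incident? : ∀ v e → Dec (Incident G v e)
  incident? v e = (proj₁ (ends e) F.≟ v) ⊎-dec (proj₂ (ends e) F.≟ v)

  first-incident : Fin n → Maybe (Fin m)
  first-incident v with FP.any? (incident? v)
  ... | yes (e , _) = just e
  ... | no _ = nothing

  first-incident-incident : ∀ {v e} → first-incident v ≡ just e → Incident G v e
  first-incident-incident {v} eq with FP.any? (incident? v)
  first-incident-incident refl | yes (_ , i) = i

  first-incident-exists : ∀ {v e} → Incident G v e → ∃ λ e′ → first-incident v ≡ just e′
  first-incident-exists {v} {e} i with FP.any? (incident? v)
  ... | yes (e′ , _) = e′ , refl
  ... | no none = ⊥-elim (none (e , i))

  module FromAssignment {s} (valid : Valid s m) where

    Selected : Fin n → Fin m → Set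
    Selected v e = Owns s m v e ⊎ (Root s m v × first-incident v ≡ just e)

    selected? : Decidable Selected
    selected? v e = owns? s m v e ⊎-dec (¬? (owned? s m v) ×-dec Maybe.≡-dec F._≟_ (first-incident v) (just e))

    selection : Selection Selected
    selection = record { incident = incident ; functional = functional ; total = total ; covering = covering }
      where
        incident : ∀ {v e} → Selected v e → Incident G v e
        incident (inj₁ o) = owns-incident {s} o
        incident (inj₂ (_ , first)) = first-incident-incident first

        functional : ∀ {v e e′} → Selected v e → Selected v e′ → e ≡ e′
        functional (inj₁ o) (inj₁ o′) = valid o o′
        functional (inj₁ o) (inj₂ (root , _)) = ⊥-elim (root (_ , o))
        functional (inj₂ (root , _)) (inj₁ o′) = ⊥-elim (root (_ , o′))
        functional (inj₂ (_ , first)) (inj₂ (_ , first′)) = Maybe.just-injective (trans (sym first) first′)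

        total : ∀ v → (∃ λ e → Incident G v e) → ∃ (Selected v)
        total v (e , i) with owned? s m v
        ... | yes (e′ , o) = e′ , inj₁ o
        ... | no root = proj₁ (first-incident-exists i) , inj₂ (root , proj₂ (first-incident-exists i))

        covering : ∀ e → Selected (proj₁ (ends e)) e ⊎ Selected (proj₂ (ends e)) e
        covering e with owner-incident s e
        ... | inj₁ p = inj₁ (inj₁ (FP.toℕ<n e , sym p))
        ... | inj₂ p = inj₂ (inj₁ (FP.toℕ<n e , sym p))

lemma2 : (G : Multigraph) → HasFullFunctionalOrientation G ⇔ ComponentsAtMostUnicyclic G
lemma2 G = mk⇔ orientation⇒unicyclic unicyclic⇒orientation
  where
    open Multigraph G using (m)

    orientation⇒unicyclic : HasFullFunctionalOrientation G → ComponentsAtMostUnicyclic G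
    orientation⇒unicyclic (_ , functional , full) = selection⇒unicyclic G (orientation⇒selection G functional full)

    unicyclic⇒orientation : ComponentsAtMostUnicyclic G → HasFullFunctionalOrientation G
    unicyclic⇒orientation unicyclic =
      selection⇒orientation G (FromAssignment.selected? G valid) (FromAssignment.selection G valid)
      where
        valid : Valid G (proj₁ (assign-all G unicyclic m ℕP.≤-refl)) m
        valid = proj₂ (assign-all G unicyclic m ℕP.≤-refl)
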